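{- The following theories do not have the amalgamation property: (a) the theory of structures $(D,S,\le,\le')$ where $S$ is an antisymmetric binary relation and $\le$, $\le'$ are two partial orders both finer than $S$ (i.e. $\le\,\subseteq S$ and $\le'\,\subseteq S$); (b) the theory of structures with an antisymmetric binary relation $S$ and two transitive binary relations both finer than $S$; (c) the theory of structures $(D,\le,S,f)$ where $\le$ is a partial order, $S$ is an antisymmetric binary relation coarser than $\le$ (i.e. $\le\,\subseteq S$), and $f$ is a bijective unary operation which is $S$-preserving ($x\,S\,y$ implies $f(x)\,S\,f(y)$).
   Context: A theory has the amalgamation property (AP) if whenever $\mathbf{A},\mathbf{B},\mathbf{C}$ are models with $\mathbf{C}$ a substructure of both $\mathbf{A}$ and $\mathbf{B}$ and $C=A\cap B$, there are a model $\mathbf{D}$ and embeddings of $\mathbf{A}$ and $\mathbf{B}$ into $\mathbf{D}$ that agree on $C$. -}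

module Defs where

open import Level using (0ℓ)
open import Data.Product using (Σ; _×_; _,_)
open import Function using (_∘_)
open import Function.Bundles using (_⇔_)
open import Function.Definitions using (Injective; Bijective)
open import Relation.Binary.Core using (Rel; _⇒_)
open import Relation.Binary.Definitions using (Antisymmetric; Transitive)
open import Relation.Binary.Structures using (IsPartialOrder)
open import Relation.Binary.PropositionalEquality using (_≡_)

record ModelA : Set₁ where
  field
    D    : Set
    S    : Rel D 0ℓ
    _≤_  : Rel D 0ℓ
    _≤'_ : Rel D 0ℓ
    S-antisym : Antisymmetric _≡_ S
    ≤-po      : IsPartialOrder _≡_ _≤_
    ≤'-po     : IsPartialOrder _≡_ _≤'_
    ≤⊆S       : _≤_ ⇒ S
    ≤'⊆S      : _≤'_ ⇒ S

record EmbA (M N : ModelA) : Set where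
  private
    module M = ModelA M
    module N = ModelA N
  field
    map   : M.D → N.D
    inj   : Injective _≡_ _≡_ map
    S-iff  : ∀ x y → M.S x y ⇔ N.S (map x) (map y)
    ≤-iff  : ∀ x y → M._≤_ x y ⇔ N._≤_ (map x) (map y)
    ≤'-iff : ∀ x y → M._≤'_ x y ⇔ N._≤'_ (map x) (map y)

APA : Set₁
APA = (A B C : ModelA) (i : EmbA C A) (j : EmbA C B) →
      Σ ModelA λ D → Σ (EmbA A D) λ g → Σ (EmbA B D) λ h →
        ∀ c → EmbA.map g (EmbA.map i c) ≡ EmbA.map h (EmbA.map j c)

record ModelB : Set₁ where
  field
    D  : Set
    S  : Rel D 0ℓ
    R  : Rel D 0ℓ
    R' : Rel D 0ℓ
    S-antisym : Antisymmetric _≡_ S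
    R-trans   : Transitive R
    R'-trans  : Transitive R'
    R⊆S       : R ⇒ S
    R'⊆S      : R' ⇒ S

record EmbB (M N : ModelB) : Set where
  private
    module M = ModelB M
    module N = ModelB N
  field
    map   : M.D → N.D
    inj   : Injective _≡_ _≡_ map
    S-iff  : ∀ x y → M.S x y ⇔ N.S (map x) (map y)
    R-iff  : ∀ x y → M.R x y ⇔ N.R (map x) (map y)
    R'-iff : ∀ x y → M.R' x y ⇔ N.R' (map x) (map y)

APB : Set₁
APB = (A B C : ModelB) (i : EmbB C A) (j : EmbB C B) →
      Σ ModelB λ D → Σ (EmbB A D) λ g → Σ (EmbB B D) λ h →
        ∀ c → EmbB.map g (EmbB.map i c) ≡ EmbB.map h (EmbB.map j c)

record ModelC : Set₁ where
  field
    D   : Set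
    _≤_ : Rel D 0ℓ
    S   : Rel D 0ℓ
    f   : D → D
    ≤-po      : IsPartialOrder _≡_ _≤_
    S-antisym : Antisymmetric _≡_ S
    ≤⊆S       : _≤_ ⇒ S
    f-bij     : Bijective _≡_ _≡_ f
    f-pres-S  : ∀ {x y} → S x y → S (f x) (f y)

record EmbC (M N : ModelC) : Set where
  private
    module M = ModelC M
    module N = ModelC N
  field
    map   : M.D → N.D
    inj   : Injective _≡_ _≡_ map
    ≤-iff : ∀ x y → M._≤_ x y ⇔ N._≤_ (map x) (map y)
    S-iff : ∀ x y → M.S x y ⇔ N.S (map x) (map y)
    f-hom : ∀ x → map (M.f x) ≡ N.f (map x)

APC : Set₁
APC = (A B C : ModelC) (i : EmbC C A) (j : EmbC C B) →
      Σ ModelC λ D → Σ (EmbC A D) λ g → Σ (EmbC B D) λ h →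
        ∀ c → EmbC.map g (EmbC.map i c) ≡ EmbC.map h (EmbC.map j c)

{-# OPTIONS --safe #-}
module Submission where

-- Extend the discrete structure {c, d} to A by a point x with x ≤ c and d ≤' x, and to B by a
-- point y with c ≤ y and y ≤' d. In an amalgam x ≤ c ≤ y and y ≤' d ≤' x, so x S y and y S x;
-- antisymmetry of S forces x = y, and then x ≤ c ≤ x forces x = c, although x ≠ c in A.
-- For (c) the second chain becomes f y ≤ d ≤ f x: S-preservation turns x S y into f x S f y,
-- so f x = f y, and injectivity of f gives x = y again.

open import Defs
open import Level using (0ℓ)
open import Data.Empty using (⊥)
open import Data.Nat using (ℕ; _<_)
open import Data.Nat.Properties using (<-asym; n<1+n)
open import Data.Product using (_×_; _,_; proj₁)
open import Data.Sum using (inj₁; inj₂)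
import Data.Sum as Sum
open import Function using (id; _on_)
open import Function.Bundles using (_⇔_; mk⇔; Equivalence)
open import Function.Consequences using (inverseᵇ⇒bijective)
open import Function.Consequences.Propositional
  using (strictlyInverseˡ⇒inverseˡ; strictlyInverseʳ⇒inverseʳ)
open import Function.Construct.Identity using (bijective)
open import Function.Definitions using (Injective; Bijective)
open import Relation.Binary.Core using (Rel; _⇒_; _=[_]⇒_)
open import Relation.Binary.Definitions using (Antisymmetric; Asymmetric; Transitive)
open import Relation.Binary.Structures using (IsPartialOrder)
open import Relation.Binary.Construct.Union using (_∪_)
open import Relation.Binary.Construct.Closure.Reflexive using (ReflClosure; refl; [_])
import Relation.Binary.Construct.Closure.Reflexive as Refl
import Relation.Binary.Construct.Closure.Reflexive.Properties as Refl
open import Relation.Binary.PropositionalEquality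
  using (_≡_; refl; sym; trans; subst; subst₂)
import Relation.Binary.PropositionalEquality.Properties as ≡
open import Relation.Nullary using (¬_; contradiction)

open Equivalence using (to)

module _ {X : Set} {E : Rel X 0ℓ} where

  reflClosure-isPartialOrder : Transitive E → Asymmetric E → IsPartialOrder _≡_ (ReflClosure E)
  reflClosure-isPartialOrder E-trans E-asym = record
    { isPreorder = Refl.isPreorder E-trans
    ; antisym    = Refl.antisym _≡_ refl E-asym
    }

  ≡⇔reflClosure-onEdgeless : {C : Set} {i : C → X} → Injective _≡_ _≡_ i →
                             (∀ a b → ¬ E (i a) (i b)) →
                             ∀ a b → (a ≡ b) ⇔ ReflClosure E (i a) (i b)
  ≡⇔reflClosure-onEdgeless i-inj edgeless a b =
    mk⇔ (λ { refl → refl }) (λ r → Sum.[ i-inj , (λ e → contradiction e (edgeless a b)) ] (Refl.toSum r))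

  rank-increasing⇒asymmetric : (ρ : X → ℕ) → E ⇒ (_<_ on ρ) → Asymmetric E
  rank-increasing⇒asymmetric ρ increasing e e′ = <-asym (increasing e) (increasing e′)

involutive⇒bijective : {X : Set} {f : X → X} → (∀ x → f (f x) ≡ x) → Bijective _≡_ _≡_ f
involutive⇒bijective {f = f} f-involutive = inverseᵇ⇒bijective _≡_ refl sym trans
  (strictlyInverseˡ⇒inverseˡ f f-involutive , strictlyInverseʳ⇒inverseʳ f f-involutive)

squeeze : {X : Set} {S R : Rel X 0ℓ} → Antisymmetric _≡_ S → R ⇒ S →
          ∀ {x c y} → R x c → R c y → x ≡ y → x ≡ c
squeeze S-antisym R⊆S xRc cRy refl = S-antisym (R⊆S xRc) (R⊆S cRy)

crossed-chains-collapse : (M : ModelB) → let open ModelB M in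
                          ∀ {x c y d} → R x c → R c y → R' y d → R' d x → x ≡ c
crossed-chains-collapse M xRc cRy yR'd dR'x =
  squeeze S-antisym R⊆S xRc cRy
    (S-antisym (R⊆S (R-trans xRc cRy)) (R'⊆S (R'-trans yR'd dR'x)))
  where open ModelB M

swapped-chains-collapse : (M : ModelC) → let open ModelC M in
                          ∀ {x c y d} → x ≤ c → c ≤ y → f y ≤ d → d ≤ f x → x ≡ c
swapped-chains-collapse M {x} {c} {y} {d} x≤c c≤y fy≤d d≤fx =
  squeeze S-antisym ≤⊆S x≤c c≤y (proj₁ f-bij fx≡fy)
  where
  open ModelC M
  open IsPartialOrder ≤-po using () renaming (trans to ≤-trans)
  fx≡fy : f x ≡ f y
  fx≡fy = S-antisym (f-pres-S (≤⊆S (≤-trans x≤c c≤y))) (≤⊆S (≤-trans fy≤d d≤fx))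

forget : ModelA → ModelB
forget M = record
  { D = D ; S = S ; R = _≤_ ; R' = _≤'_
  ; S-antisym = S-antisym
  ; R-trans = IsPartialOrder.trans ≤-po ; R'-trans = IsPartialOrder.trans ≤'-po
  ; R⊆S = ≤⊆S ; R'⊆S = ≤'⊆S
  }
  where open ModelA M

forget-emb : {M N : ModelA} → EmbA M N → EmbB (forget M) (forget N)
forget-emb e = record { map = map ; inj = inj ; S-iff = S-iff ; R-iff = ≤-iff ; R'-iff = ≤'-iff }
  where open EmbA e

discreteA : Set → ModelA
discreteA C = record
  { D = C ; S = _≡_ ; _≤_ = _≡_ ; _≤'_ = _≡_
  ; S-antisym = λ p _ → p
  ; ≤-po = ≡.isPartialOrder ; ≤'-po = ≡.isPartialOrder
  ; ≤⊆S = id ; ≤'⊆S = id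
  }

discreteC : Set → ModelC
discreteC C = record
  { D = C ; _≤_ = _≡_ ; S = _≡_ ; f = id
  ; ≤-po = ≡.isPartialOrder ; S-antisym = λ p _ → p ; ≤⊆S = id
  ; f-bij = bijective _≡_ ; f-pres-S = id
  }

module TwoOrders {X : Set} (E E' : Rel X 0ℓ) (E-trans : Transitive E) (E'-trans : Transitive E')
                 (asym : Asymmetric (E ∪ E')) where

  model : ModelA
  model = record
    { D = X ; S = ReflClosure (E ∪ E') ; _≤_ = ReflClosure E ; _≤'_ = ReflClosure E'
    ; S-antisym = Refl.antisym _≡_ refl asym
    ; ≤-po = reflClosure-isPartialOrder E-trans (λ e e′ → asym (inj₁ e) (inj₁ e′))
    ; ≤'-po = reflClosure-isPartialOrder E'-trans (λ e e′ → asym (inj₂ e) (inj₂ e′))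
    ; ≤⊆S = Refl.map inj₁ ; ≤'⊆S = Refl.map inj₂
    }

  embedding : {C : Set} {i : C → X} → Injective _≡_ _≡_ i → (∀ a b → ¬ (E ∪ E') (i a) (i b)) →
              EmbA (discreteA C) model
  embedding {i = i} i-inj edgeless = record
    { map = i ; inj = i-inj
    ; S-iff = ≡⇔reflClosure-onEdgeless i-inj edgeless
    ; ≤-iff = ≡⇔reflClosure-onEdgeless i-inj (λ a b e → edgeless a b (inj₁ e))
    ; ≤'-iff = ≡⇔reflClosure-onEdgeless i-inj (λ a b e → edgeless a b (inj₂ e))
    }

module SwapClosedOrder {X : Set} (f : X → X) (f-involutive : ∀ x → f (f x) ≡ x)
                       (E : Rel X 0ℓ) (E-trans : Transitive E)
                       (ρ : X → ℕ) (ρ-f-invariant : ∀ x → ρ (f x) ≡ ρ x)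
                       (ρ-increasing : E ⇒ (_<_ on ρ)) where

  Edge : Rel X 0ℓ
  Edge = E ∪ (E on f)

  f-preserves-Edge : Edge =[ f ]⇒ Edge
  f-preserves-Edge {u} {v} (inj₁ e) = inj₂ (subst₂ E (sym (f-involutive u)) (sym (f-involutive v)) e)
  f-preserves-Edge (inj₂ e) = inj₁ e

  ρ-increasing-Edge : Edge ⇒ (_<_ on ρ)
  ρ-increasing-Edge (inj₁ e) = ρ-increasing e
  ρ-increasing-Edge {u} {v} (inj₂ e) = subst₂ _<_ (ρ-f-invariant u) (ρ-f-invariant v) (ρ-increasing e)

  model : ModelC
  model = record
    { D = X ; _≤_ = ReflClosure E ; S = ReflClosure Edge ; f = f
    ; ≤-po = reflClosure-isPartialOrder E-trans (rank-increasing⇒asymmetric ρ ρ-increasing)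
    ; S-antisym = Refl.antisym _≡_ refl (rank-increasing⇒asymmetric ρ ρ-increasing-Edge)
    ; ≤⊆S = Refl.map inj₁
    ; f-bij = involutive⇒bijective f-involutive
    ; f-pres-S = Refl.map f-preserves-Edge
    }

  embedding : {C : Set} {i : C → X} → Injective _≡_ _≡_ i → (∀ a → f (i a) ≡ i a) →
              (∀ a b → ¬ Edge (i a) (i b)) → EmbC (discreteC C) model
  embedding {i = i} i-inj f-fixes edgeless = record
    { map = i ; inj = i-inj
    ; ≤-iff = ≡⇔reflClosure-onEdgeless i-inj (λ a b e → edgeless a b (inj₁ e))
    ; S-iff = ≡⇔reflClosure-onEdgeless i-inj edgeless
    ; f-hom = λ a → sym (f-fixes a)
    }

data Base : Set where
  c d : Base

module CrossedChains where

  data Point : Set where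
    ⌜_⌝ : Base → Point
    new  : Point

  ⌜⌝-injective : Injective _≡_ _≡_ ⌜_⌝
  ⌜⌝-injective refl = refl

  data A≤ : Rel Point 0ℓ where
    new≤c : A≤ new ⌜ c ⌝

  data A≤' : Rel Point 0ℓ where
    d≤'new : A≤' ⌜ d ⌝ new

  data B≤ : Rel Point 0ℓ where
    c≤new : B≤ ⌜ c ⌝ new

  data B≤' : Rel Point 0ℓ where
    new≤'d : B≤' new ⌜ d ⌝

  A≤-transitive : Transitive A≤
  A≤-transitive new≤c ()

  A≤'-transitive : Transitive A≤'
  A≤'-transitive d≤'new ()

  B≤-transitive : Transitive B≤
  B≤-transitive c≤new ()

  B≤'-transitive : Transitive B≤'
  B≤'-transitive new≤'d ()

  A-asymmetric : Asymmetric (A≤ ∪ A≤')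
  A-asymmetric (inj₁ new≤c)  (inj₁ ())
  A-asymmetric (inj₁ new≤c)  (inj₂ ())
  A-asymmetric (inj₂ d≤'new) (inj₁ ())
  A-asymmetric (inj₂ d≤'new) (inj₂ ())

  B-asymmetric : Asymmetric (B≤ ∪ B≤')
  B-asymmetric (inj₁ c≤new)  (inj₁ ())
  B-asymmetric (inj₁ c≤new)  (inj₂ ())
  B-asymmetric (inj₂ new≤'d) (inj₁ ())
  B-asymmetric (inj₂ new≤'d) (inj₂ ())

  module 𝒜 = TwoOrders A≤ A≤' A≤-transitive A≤'-transitive A-asymmetric
  module ℬ = TwoOrders B≤ B≤' B≤-transitive B≤'-transitive B-asymmetric

  A B C : ModelA
  A = 𝒜.model
  B = ℬ.model
  C = discreteA Base

  i : EmbA C A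
  i = 𝒜.embedding ⌜⌝-injective (λ { _ _ (inj₁ ()) ; _ _ (inj₂ ()) })

  j : EmbA C B
  j = ℬ.embedding ⌜⌝-injective (λ { _ _ (inj₁ ()) ; _ _ (inj₂ ()) })

  no-amalgam : (M : ModelB) (g : EmbB (forget A) M) (h : EmbB (forget B) M) →
               (∀ b → EmbB.map g ⌜ b ⌝ ≡ EmbB.map h ⌜ b ⌝) → ⊥
  no-amalgam M g h glue = contradiction (G.inj x≡c) λ ()
    where
    open ModelB M
    module G = EmbB g
    module H = EmbB h
    x≡c : G.map new ≡ G.map ⌜ c ⌝
    x≡c = crossed-chains-collapse M
      (to (G.R-iff new ⌜ c ⌝) [ new≤c ])
      (subst (λ z → R z (H.map new)) (sym (glue c)) (to (H.R-iff ⌜ c ⌝ new) [ c≤new ]))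
      (subst (R' (H.map new)) (sym (glue d)) (to (H.R'-iff new ⌜ d ⌝) [ new≤'d ]))
      (to (G.R'-iff ⌜ d ⌝ new) [ d≤'new ])

module SwappedChains where

  data Point : Set where
    ⌜_⌝      : Base → Point
    new new' : Point

  ⌜⌝-injective : Injective _≡_ _≡_ ⌜_⌝
  ⌜⌝-injective refl = refl

  swap : Point → Point
  swap ⌜ b ⌝ = ⌜ b ⌝
  swap new   = new'
  swap new'  = new

  swap-involutive : ∀ p → swap (swap p) ≡ p
  swap-involutive ⌜ _ ⌝ = refl
  swap-involutive new   = refl
  swap-involutive new'  = refl

  data A≤ : Rel Point 0ℓ where
    new≤c  : A≤ new ⌜ c ⌝
    d≤new' : A≤ ⌜ d ⌝ new'

  data B≤ : Rel Point 0ℓ where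
    c≤new  : B≤ ⌜ c ⌝ new
    new'≤d : B≤ new' ⌜ d ⌝

  rankA rankB : Point → ℕ
  rankA ⌜ d ⌝ = 0
  rankA ⌜ c ⌝ = 2
  rankA _     = 1
  rankB ⌜ c ⌝ = 0
  rankB ⌜ d ⌝ = 2
  rankB _     = 1

  A≤-transitive : Transitive A≤
  A≤-transitive new≤c  ()
  A≤-transitive d≤new' ()

  B≤-transitive : Transitive B≤
  B≤-transitive c≤new  ()
  B≤-transitive new'≤d ()

  rankA-increasing : A≤ ⇒ (_<_ on rankA)
  rankA-increasing new≤c  = n<1+n 1
  rankA-increasing d≤new' = n<1+n 0

  rankB-increasing : B≤ ⇒ (_<_ on rankB)
  rankB-increasing c≤new  = n<1+n 0
  rankB-increasing new'≤d = n<1+n 1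

  rankA-swap-invariant : ∀ p → rankA (swap p) ≡ rankA p
  rankA-swap-invariant ⌜ _ ⌝ = refl
  rankA-swap-invariant new   = refl
  rankA-swap-invariant new'  = refl

  rankB-swap-invariant : ∀ p → rankB (swap p) ≡ rankB p
  rankB-swap-invariant ⌜ _ ⌝ = refl
  rankB-swap-invariant new   = refl
  rankB-swap-invariant new'  = refl

  module 𝒜 = SwapClosedOrder swap swap-involutive A≤ A≤-transitive rankA rankA-swap-invariant rankA-increasing
  module ℬ = SwapClosedOrder swap swap-involutive B≤ B≤-transitive rankB rankB-swap-invariant rankB-increasing

  A B C : ModelC
  A = 𝒜.model
  B = ℬ.model
  C = discreteC Base

  i : EmbC C A
  i = 𝒜.embedding ⌜⌝-injective (λ _ → refl) (λ { _ _ (inj₁ ()) ; _ _ (inj₂ ()) })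

  j : EmbC C B
  j = ℬ.embedding ⌜⌝-injective (λ _ → refl) (λ { _ _ (inj₁ ()) ; _ _ (inj₂ ()) })

  no-amalgam : (M : ModelC) (g : EmbC A M) (h : EmbC B M) →
               (∀ b → EmbC.map g ⌜ b ⌝ ≡ EmbC.map h ⌜ b ⌝) → ⊥
  no-amalgam M g h glue = contradiction (G.inj x≡c) λ ()
    where
    open ModelC M
    module G = EmbC g
    module H = EmbC h
    x≡c : G.map new ≡ G.map ⌜ c ⌝
    x≡c = swapped-chains-collapse M
      (to (G.≤-iff new ⌜ c ⌝) [ new≤c ])
      (subst (_≤ H.map new) (sym (glue c)) (to (H.≤-iff ⌜ c ⌝ new) [ c≤new ]))
      (subst₂ _≤_ (H.f-hom new) (sym (glue d)) (to (H.≤-iff new' ⌜ d ⌝) [ new'≤d ]))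
      (subst (G.map ⌜ d ⌝ ≤_) (G.f-hom new) (to (G.≤-iff ⌜ d ⌝ new') [ d≤new' ]))

proposition3p5 : ¬ APA × ¬ APB × ¬ APC
proposition3p5 = ¬APA , ¬APB , ¬APC
  where
  open CrossedChains using (A; B; C; i; j; no-amalgam)
  ¬APA : ¬ APA
  ¬APA ap = let M , g , h , glue = ap A B C i j
            in no-amalgam (forget M) (forget-emb g) (forget-emb h) glue
  ¬APB : ¬ APB
  ¬APB ap = let M , g , h , glue = ap (forget A) (forget B) (forget C) (forget-emb i) (forget-emb j)
            in no-amalgam M g h glue
  ¬APC : ¬ APC
  ¬APC ap = let M , g , h , glue = ap S.A S.B S.C S.i S.j
            in S.no-amalgam M g h glue
    where module S = SwappedChains
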